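{- Let $m\ge4$ and let $A$ be an independent set of vertices in $H_m$. Then for every $i\in\mathbb{Z}_m$, \[ \varepsilon_i(A)+\max_{x\in\mathbb{Z}_2^2}|A_2(i+2,x)|+|A_1(i+3)|\le 2+\chi[A_1(i+2)\ne\emptyset]+\chi[A_1(i+3)\ne\emptyset]. \]
   Context: For $m\ge4$, $H_m$ is the $4$-graph with vertex set $\mathbb{Z}_m\times\mathbb{Z}_2^2\times\mathbb{Z}_2^2\times\mathbb{Z}_2^2$, vertices written $(i,x,y,z)$, in which four distinct vertices form an edge iff they can be labeled $v_1,v_2,v_3,v_4$ so that one of the following holds (indices $i$ in $\mathbb{Z}_m$): (1) $v_t=(i,x,y,z_t)$ for $t=1,2,3,4$; (2) $v_t=(i,x_t,y_t,z_t)$ for $t=1,\dots,4$, with $x_1+x_2+x_3+x_4=0$ and $(x_k,y_k)\ne(x_l,y_l)$ for $k\ne l$; (3) $v_1=(i,x_1,y_1',z_1')$, $v_2=(i,x_1,y_1'',z_1'')$, $v_3=(i+1,x_2',y_2',z_2')$, $v_4=(i+1,x_2'',y_2'',z_2'')$ with $y_1'\ne y_1''$ and $y_1'+y_1''+x_2'+x_2''=0$; (4) $v_1=(i,x_1,y_1,z_1')$, $v_2=(i,x_1,y_1,z_1'')$ with $z_1'\ne z_1''$, and either (a) $v_3=(i,x_2,y_2,z_2')$, $v_4=(i,x_2,y_2,z_2'')$ with $(x_1,y_1)\ne(x_2,y_2)$ and $z_2'\ne z_2''$; or (b) $v_3=(i+2,x_2,y_2',z_2')$, $v_4=(i+2,x_2,y_2'',z_2'')$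 with $y_2'\ne y_2''$; or (c) $v_3=(i+3,x_2',y_2',z_2')$, $v_4=(i+3,x_2'',y_2'',z_2'')$ with $z_1'+z_1''+x_2'+x_2''=0$. A vertex set is independent if it contains no edge. For a vertex set $A$: $A_1(i)=\{x:\exists y,z,\ (i,x,y,z)\in A\}$, $A_2(i,x)=\{y:\exists z,\ (i,x,y,z)\in A\}$, $A_3(i,x,y)=\{z:(i,x,y,z)\in A\}$, and $\varepsilon_i(A)=\sum_{x,y\in\mathbb{Z}_2^2}\max\{0,|A_3(i,x,y)|-1\}$. $\chi[B]$ is $1$ if condition $B$ holds and $0$ otherwise. -}

module Defs where

open import Data.Bool using (Bool; true; false; _xor_; _∨_; if_then_else_)
open import Data.Nat using (ℕ; zero; suc; _+_; _∸_; _⊔_; _<_; NonZero)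
open import Data.Nat.DivMod using (_mod_)
open import Data.Fin using (Fin; toℕ)
open import Data.List using (List; []; _∷_; length; filterᵇ; map; foldr)
open import Data.Nat.ListAction using (sum)
open import Data.Bool.ListAction using (any)
open import Relation.Nullary using (¬_)
open import Data.Product using (_×_; _,_)
open import Data.Sum using (_⊎_)
open import Relation.Binary.PropositionalEquality using (_≡_; _≢_)

Z22 : Set
Z22 = Bool × Bool

_⊕_ : Z22 → Z22 → Z22
(a , b) ⊕ (c , d) = (a xor c) , (b xor d)
infixl 6 _⊕_

0² : Z22
0² = false , false

allZ22 : List Z22
allZ22 = (false , false) ∷ (false , true) ∷ (true , false) ∷ (true , true) ∷ []

_+ₘ_ : {m : ℕ} .{{_ : NonZero m}} → Fin m → ℕ → Fin m
_+ₘ_ {m} i k = (toℕ i + k) mod m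

Vtx : ℕ → Set
Vtx m = Fin m × Z22 × Z22 × Z22

module _ {m : ℕ} .{{_ : NonZero m}} where

  Rule1 : Vtx m → Vtx m → Vtx m → Vtx m → Set
  Rule1 (i₁ , x₁ , y₁ , z₁) (i₂ , x₂ , y₂ , z₂) (i₃ , x₃ , y₃ , z₃) (i₄ , x₄ , y₄ , z₄) =
    i₂ ≡ i₁ × i₃ ≡ i₁ × i₄ ≡ i₁ ×
    x₂ ≡ x₁ × x₃ ≡ x₁ × x₄ ≡ x₁ ×
    y₂ ≡ y₁ × y₃ ≡ y₁ × y₄ ≡ y₁

  Rule2 : Vtx m → Vtx m → Vtx m → Vtx m → Set
  Rule2 (i₁ , x₁ , y₁ , z₁) (i₂ , x₂ , y₂ , z₂) (i₃ , x₃ , y₃ , z₃) (i₄ , x₄ , y₄ , z₄) =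
    i₂ ≡ i₁ × i₃ ≡ i₁ × i₄ ≡ i₁ ×
    x₁ ⊕ x₂ ⊕ x₃ ⊕ x₄ ≡ 0² ×
    (x₁ , y₁) ≢ (x₂ , y₂) × (x₁ , y₁) ≢ (x₃ , y₃) × (x₁ , y₁) ≢ (x₄ , y₄) ×
    (x₂ , y₂) ≢ (x₃ , y₃) × (x₂ , y₂) ≢ (x₄ , y₄) × (x₃ , y₃) ≢ (x₄ , y₄)

  Rule3 : Vtx m → Vtx m → Vtx m → Vtx m → Set
  Rule3 (i₁ , x₁ , y₁ , z₁) (i₂ , x₂ , y₂ , z₂) (i₃ , x₃ , y₃ , z₃) (i₄ , x₄ , y₄ , z₄) =
    i₂ ≡ i₁ × i₃ ≡ i₁ +ₘ 1 × i₄ ≡ i₁ +ₘ 1 ×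
    x₂ ≡ x₁ × y₁ ≢ y₂ × y₁ ⊕ y₂ ⊕ x₃ ⊕ x₄ ≡ 0²

  Rule4 : Vtx m → Vtx m → Vtx m → Vtx m → Set
  Rule4 (i₁ , x₁ , y₁ , z₁) (i₂ , x₂ , y₂ , z₂) (i₃ , x₃ , y₃ , z₃) (i₄ , x₄ , y₄ , z₄) =
    i₂ ≡ i₁ × x₂ ≡ x₁ × y₂ ≡ y₁ × z₁ ≢ z₂ ×
    ( (i₃ ≡ i₁ × i₄ ≡ i₁ × x₄ ≡ x₃ × y₄ ≡ y₃ × (x₁ , y₁) ≢ (x₃ , y₃) × z₃ ≢ z₄)
    ⊎ (i₃ ≡ i₁ +ₘ 2 × i₄ ≡ i₁ +ₘ 2 × x₄ ≡ x₃ × y₃ ≢ y₄)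
    ⊎ (i₃ ≡ i₁ +ₘ 3 × i₄ ≡ i₁ +ₘ 3 × z₁ ⊕ z₂ ⊕ x₃ ⊕ x₄ ≡ 0²) )

  EdgeLabelled : Vtx m → Vtx m → Vtx m → Vtx m → Set
  EdgeLabelled v₁ v₂ v₃ v₄ =
    Rule1 v₁ v₂ v₃ v₄ ⊎ Rule2 v₁ v₂ v₃ v₄ ⊎ Rule3 v₁ v₂ v₃ v₄ ⊎ Rule4 v₁ v₂ v₃ v₄

  -- {v1,v2,v3,v4} (four distinct vertices) is an edge of H_m iff some labelling
  -- satisfies a rule; quantifying over all ordered tuples covers all labellings.
  Independent : (Vtx m → Bool) → Set
  Independent A = (v₁ v₂ v₃ v₄ : Vtx m) →
    v₁ ≢ v₂ → v₁ ≢ v₃ → v₁ ≢ v₄ → v₂ ≢ v₃ → v₂ ≢ v₄ → v₃ ≢ v₄ →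
    A v₁ ≡ true → A v₂ ≡ true → A v₃ ≡ true → A v₄ ≡ true →
    ¬ EdgeLabelled v₁ v₂ v₃ v₄

card : (Z22 → Bool) → ℕ
card S = length (filterᵇ S allZ22)

module _ {m : ℕ} (A : Vtx m → Bool) where

  A₃ : Fin m → Z22 → Z22 → (Z22 → Bool)
  A₃ i x y z = A (i , x , y , z)

  A₂ : Fin m → Z22 → (Z22 → Bool)
  A₂ i x y = any (A₃ i x y) allZ22

  A₁ : Fin m → (Z22 → Bool)
  A₁ i x = any (A₂ i x) allZ22

  ε : Fin m → ℕ
  ε i = sum (map (λ x → sum (map (λ y → card (A₃ i x y) ∸ 1) allZ22)) allZ22)

  maxA₂ : Fin m → ℕ
  maxA₂ i = foldr _⊔_ 0 (map (λ x → card (A₂ i x)) allZ22)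

χ≠∅ : (Z22 → Bool) → ℕ
χ≠∅ S with card S
... | zero = 0
... | suc _ = 1

-- Independence rules out each edge type of H_m in turn.  Type (1) bounds every |A₃(i,x,y)| by 3,
-- type (2) bounds every |A₂(i+2,x)| and |A₁(i+3)| by 3, and type (4a) leaves at most one cell
-- (x₀,y₀) of layer i with |A₃(i,x₀,y₀)| ≥ 2, so that ε_i(A) = |A₃(i,x₀,y₀)| − 1.  Types (3) and
-- (4c) forbid a sum of two distinct elements of A₂(i+2,x), resp. A₃(i,x₀,y₀), to equal a sum of
-- two distinct elements of A₁(i+3).  Any three distinct elements of Z₂² contain a pair with any
-- prescribed nonzero sum, so if one side has 3 elements the other has at most 1, and if it has 2
-- the other has at most 2.  When the cell (x₀,y₀) has two elements, type (4b) moreover forces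
-- |A₂(i+2,x)| ≤ 1 for every x.

module Submission where

open import Defs
open import Data.Bool using (Bool; true; false; T; T?)
import Data.Bool.Properties as Bool
open import Data.Nat using (ℕ; zero; suc; _+_; _∸_; _⊓_; _⊔_; _≤_; _<_; _%_; NonZero; z≤n; s≤s; _≤?_; _<?_)
open import Data.Nat.Properties
  using (≤-refl; ≤-trans; ≤-reflexive; ≤-pred; ≮⇒≥; <⇒≢; <-trans; m<m+n; +-monoʳ-<; ∸-monoˡ-<; +-comm; +-assoc; +-identityʳ;
         +-mono-≤; +-monoˡ-≤; +-monoʳ-≤; m+n∸n≡m; m∸n+n≡m; m+n≤o⇒m≤o∸n; m+n≤o⇒n≤o;
         m≤n⇒m∸n≡0; m≥n⇒m⊓n≡n; m≤n⇒m⊓n≡m; ⊔-lub; +-commutativeSemigroup; module ≤-Reasoning)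
open import Algebra.Properties.CommutativeSemigroup +-commutativeSemigroup using (xy∙z≈xz∙y)
open import Data.Nat.DivMod using (m<n⇒m%n≡m; m≤n⇒[n∸m]%m≡n%m; %-distribˡ-+; m%n%n≡m%n)
open import Data.Fin using (Fin; toℕ)
open import Data.Fin.Properties using (toℕ-injective; toℕ-fromℕ<; toℕ<n)
open import Data.List using (List; []; _∷_; length; filterᵇ; map; foldr)
open import Data.List.Relation.Unary.All as All using (All; _∷_)
open import Data.List.Relation.Unary.All.Properties using (all-filter)
open import Data.List.Relation.Unary.AllPairs using (_∷_)
open import Data.List.Relation.Unary.Any using (satisfied)
open import Data.List.Relation.Unary.Any.Properties using (any⁺; any⁻)
open import Data.List.Relation.Unary.Unique.Propositional using (Unique)
import Data.List.Relation.Unary.Unique.Propositional.Properties as Unique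
import Data.List.Relation.Unary.Unique.DecPropositional as DecUnique
open import Data.List.Membership.Propositional using (_∈_; lose)
open import Data.List.Membership.Propositional.Properties using (∈-filter⁺; ∈-length)
import Data.List.Membership.DecPropositional as DecMembership
open import Data.Nat.ListAction using (sum)
open import Data.Bool.ListAction using (any)
open import Data.Product using (Σ-syntax; ∃; ∃₂; _×_; _,_)
open import Data.Product.Properties using (≡-dec; ,-injectiveˡ; ,-injectiveʳ)
open import Data.Empty using (⊥)
open import Data.Sum using (_⊎_; inj₁; inj₂)
open import Function using (_∘_; Equivalence)
open import Relation.Nullary using (¬_; Dec; yes; no)
open import Relation.Nullary.Decidable using (map′; from-yes; ¬?; _×-dec_; _⊎-dec_; _→-dec_)
open import Relation.Binary.Definitions using (DecidableEquality)
open import Relation.Binary.PropositionalEquality using (_≡_; _≢_; refl; sym; trans; cong; subst; ≢-sym; module ≡-Reasoning)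

infix 4 _≟_
_≟_ : DecidableEquality Z22
_≟_ = ≡-dec Bool._≟_ Bool._≟_

all? : {P : Z22 → Set} → (∀ a → Dec (P a)) → Dec (∀ a → P a)
all? P? = map′
  (λ (p₀ , p₁ , p₂ , p₃) → λ { (false , false) → p₀ ; (false , true) → p₁ ; (true , false) → p₂ ; (true , true) → p₃ })
  (λ p → p _ , p _ , p _ , p _)
  (P? _ ×-dec P? _ ×-dec P? _ ×-dec P? _)

any? : {P : Z22 → Set} → (∀ a → Dec (P a)) → Dec (∃ P)
any? P? = map′
  (λ { (inj₁ p) → _ , p ; (inj₂ (inj₁ p)) → _ , p ; (inj₂ (inj₂ (inj₁ p))) → _ , p ; (inj₂ (inj₂ (inj₂ p))) → _ , p })
  (λ { ((false , false) , p) → inj₁ p ; ((false , true) , p) → inj₂ (inj₁ p)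
     ; ((true , false) , p) → inj₂ (inj₂ (inj₁ p)) ; ((true , true) , p) → inj₂ (inj₂ (inj₂ p)) })
  (P? _ ⊎-dec P? _ ⊎-dec P? _ ⊎-dec P? _)

≢⇒⊕≢0² : ∀ a b → a ≢ b → a ⊕ b ≢ 0²
≢⇒⊕≢0² = from-yes (all? λ a → all? λ b → ¬? (a ≟ b) →-dec ¬? (a ⊕ b ≟ 0²))

⊕≡⊕⇒sum≡0² : ∀ a b c d → a ⊕ b ≡ c ⊕ d → a ⊕ b ⊕ c ⊕ d ≡ 0²
⊕≡⊕⇒sum≡0² = from-yes (all? λ a → all? λ b → all? λ c → all? λ d → (a ⊕ b ≟ c ⊕ d) →-dec (a ⊕ b ⊕ c ⊕ d ≟ 0²))

x⊕x⊕x⊕x≡0² : ∀ x → x ⊕ x ⊕ x ⊕ x ≡ 0²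
x⊕x⊕x⊕x≡0² = from-yes (all? λ x → x ⊕ x ⊕ x ⊕ x ≟ 0²)

distinct₃⇒pair-⊕≡ : ∀ a b c d → a ≢ b → a ≢ c → b ≢ c → d ≢ 0² → a ⊕ b ≡ d ⊎ a ⊕ c ≡ d ⊎ b ⊕ c ≡ d
distinct₃⇒pair-⊕≡ = from-yes (all? λ a → all? λ b → all? λ c → all? λ d →
  ¬? (a ≟ b) →-dec ¬? (a ≟ c) →-dec ¬? (b ≟ c) →-dec ¬? (d ≟ 0²) →-dec
  (a ⊕ b ≟ d ⊎-dec a ⊕ c ≟ d ⊎-dec b ⊕ c ≟ d))

distinct₄⇒cover : ∀ a b c d → a ≢ b → a ≢ c → a ≢ d → b ≢ c → b ≢ d → c ≢ d →
                  ∀ e → e ≡ a ⊎ e ≡ b ⊎ e ≡ c ⊎ e ≡ d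
distinct₄⇒cover = from-yes (all? λ a → all? λ b → all? λ c → all? λ d →
  ¬? (a ≟ b) →-dec ¬? (a ≟ c) →-dec ¬? (a ≟ d) →-dec ¬? (b ≟ c) →-dec ¬? (b ≟ d) →-dec ¬? (c ≟ d) →-dec
  all? λ e → e ≟ a ⊎-dec e ≟ b ⊎-dec e ≟ c ⊎-dec e ≟ d)

∈-allZ22 : ∀ a → a ∈ allZ22
∈-allZ22 = from-yes (all? λ a → a ∈? allZ22) where open DecMembership _≟_

allZ22-unique : Unique allZ22
allZ22-unique = from-yes (unique? allZ22) where open DecUnique _≟_

module _ {A : Set} {P : A → Set} where

  nonempty⇒some : ∀ {xs} → All P xs → 1 ≤ length xs → ∃ P
  nonempty⇒some (p ∷ _) _ = _ , p

  distinct₂ : ∀ {xs} → Unique xs → All P xs → 2 ≤ length xs → ∃₂ λ a b → a ≢ b × P a × P b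
  distinct₂ {_ ∷ []} _ _ (s≤s ())
  distinct₂ ((a≢b ∷ _) ∷ _) (pa ∷ pb ∷ _) _ = _ , _ , a≢b , pa , pb

  distinct₃ : ∀ {xs} → Unique xs → All P xs → 3 ≤ length xs →
              Σ[ a ∈ A ] Σ[ b ∈ A ] Σ[ c ∈ A ] (a ≢ b × a ≢ c × b ≢ c) × P a × P b × P c
  distinct₃ {_ ∷ []} _ _ (s≤s ())
  distinct₃ {_ ∷ _ ∷ []} _ _ (s≤s (s≤s ()))
  distinct₃ ((a≢b ∷ a≢c ∷ _) ∷ (b≢c ∷ _) ∷ _) (pa ∷ pb ∷ pc ∷ _) _ =
    _ , _ , _ , (a≢b , a≢c , b≢c) , pa , pb , pc

  distinct₄ : ∀ {xs} → Unique xs → All P xs → 4 ≤ length xs →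
              Σ[ a ∈ A ] Σ[ b ∈ A ] Σ[ c ∈ A ] Σ[ d ∈ A ]
                (a ≢ b × a ≢ c × a ≢ d × b ≢ c × b ≢ d × c ≢ d) × P a × P b × P c × P d
  distinct₄ {_ ∷ []} _ _ (s≤s ())
  distinct₄ {_ ∷ _ ∷ []} _ _ (s≤s (s≤s ()))
  distinct₄ {_ ∷ _ ∷ _ ∷ []} _ _ (s≤s (s≤s (s≤s ())))
  distinct₄ ((a≢b ∷ a≢c ∷ a≢d ∷ _) ∷ (b≢c ∷ b≢d ∷ _) ∷ (c≢d ∷ _) ∷ _) (pa ∷ pb ∷ pc ∷ pd ∷ _) _ =
    _ , _ , _ , _ , (a≢b , a≢c , a≢d , b≢c , b≢d , c≢d) , pa , pb , pc , pd

members : (Z22 → Bool) → List Z22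
members S = filterᵇ S allZ22

members-unique : ∀ S → Unique (members S)
members-unique S = Unique.filter⁺ (T? ∘ S) allZ22-unique

members-all : ∀ S → All (λ a → S a ≡ true) (members S)
members-all S = All.map (Equivalence.to Bool.T-≡) (all-filter (T? ∘ S) allZ22)

module _ (S : Z22 → Bool) where

  member⇒card≥1 : ∀ {a} → S a ≡ true → 1 ≤ card S
  member⇒card≥1 {a} Sa = ∈-length (∈-filter⁺ (T? ∘ S) (∈-allZ22 a) (Equivalence.from Bool.T-≡ Sa))

  card≥1⇒member : 1 ≤ card S → ∃ λ a → S a ≡ true
  card≥1⇒member = nonempty⇒some (members-all S)

  card≥2⇒distinct₂ : 2 ≤ card S → ∃₂ λ a b → a ≢ b × S a ≡ true × S b ≡ true
  card≥2⇒distinct₂ = distinct₂ (members-unique S) (members-all S)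

  card≥3⇒pair-⊕≡ : 3 ≤ card S → ∀ d → d ≢ 0² →
                   ∃₂ λ a b → a ≢ b × S a ≡ true × S b ≡ true × a ⊕ b ≡ d
  card≥3⇒pair-⊕≡ 3≤card d d≢0
    with a , b , c , (a≢b , a≢c , b≢c) , Sa , Sb , Sc ← distinct₃ (members-unique S) (members-all S) 3≤card
    with distinct₃⇒pair-⊕≡ a b c d a≢b a≢c b≢c d≢0
  ... | inj₁ a⊕b≡d        = a , b , a≢b , Sa , Sb , a⊕b≡d
  ... | inj₂ (inj₁ a⊕c≡d) = a , c , a≢c , Sa , Sc , a⊕c≡d
  ... | inj₂ (inj₂ b⊕c≡d) = b , c , b≢c , Sb , Sc , b⊕c≡d

  card≥4⇒full : 4 ≤ card S → ∀ e → S e ≡ true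
  card≥4⇒full 4≤card e
    with a , b , c , d , (a≢b , a≢c , a≢d , b≢c , b≢d , c≢d) , Sa , Sb , Sc , Sd
           ← distinct₄ (members-unique S) (members-all S) 4≤card
    with distinct₄⇒cover a b c d a≢b a≢c a≢d b≢c b≢d c≢d e
  ... | inj₁ refl               = Sa
  ... | inj₂ (inj₁ refl)        = Sb
  ... | inj₂ (inj₂ (inj₁ refl)) = Sc
  ... | inj₂ (inj₂ (inj₂ refl)) = Sd

  any-allZ22⁻ : any S allZ22 ≡ true → ∃ λ a → S a ≡ true
  any-allZ22⁻ h with a , Sa ← satisfied (any⁻ S allZ22 (Equivalence.from Bool.T-≡ h)) =
    a , Equivalence.to Bool.T-≡ Sa

  any-allZ22⁺ : ∀ {a} → S a ≡ true → any S allZ22 ≡ true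
  any-allZ22⁺ {a} Sa =
    Equivalence.to Bool.T-≡ (any⁺ S (lose (∈-allZ22 a) (Equivalence.from Bool.T-≡ Sa)))

χ≠∅≡1⊓card : ∀ S → χ≠∅ S ≡ 1 ⊓ card S
χ≠∅≡1⊓card S with card S
... | zero  = refl
... | suc _ = refl

-- Sums of two distinct elements

record CommonSum (S T : Z22 → Bool) : Set where
  constructor common-sum
  field
    {a b c d} : Z22
    a≢b : a ≢ b
    c≢d : c ≢ d
    Sa  : S a ≡ true
    Sb  : S b ≡ true
    Tc  : T c ≡ true
    Td  : T d ≡ true
    a⊕b≡c⊕d : a ⊕ b ≡ c ⊕ d

Tradeoff : ℕ → ℕ → Set
Tradeoff u c = (3 ≤ u → c ≤ 1) × (2 ≤ u → c ≤ 2)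

no-common-sum⇒tradeoff : ∀ {S T} → ¬ CommonSum S T → Tradeoff (card S) (card T)
no-common-sum⇒tradeoff {S} {T} ¬common = large-S , medium-S
  where
  large-S : 3 ≤ card S → card T ≤ 1
  large-S 3≤S = ≮⇒≥ λ 2≤T →
    let (c , d , c≢d , Tc , Td) = card≥2⇒distinct₂ T 2≤T
        (a , b , a≢b , Sa , Sb , a⊕b≡c⊕d) = card≥3⇒pair-⊕≡ S 3≤S (c ⊕ d) (≢⇒⊕≢0² c d c≢d)
    in ¬common (common-sum a≢b c≢d Sa Sb Tc Td a⊕b≡c⊕d)
  medium-S : 2 ≤ card S → card T ≤ 2
  medium-S 2≤S = ≮⇒≥ λ 3≤T →
    let (a , b , a≢b , Sa , Sb) = card≥2⇒distinct₂ S 2≤S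
        (c , d , c≢d , Tc , Td , c⊕d≡a⊕b) = card≥3⇒pair-⊕≡ T 3≤T (a ⊕ b) (≢⇒⊕≢0² a b a≢b)
    in ¬common (common-sum a≢b c≢d Sa Sb Tc Td (sym c⊕d≡a⊕b))

sum-allZ22-concentrated : (f : Z22 → ℕ) (c : Z22) → (∀ a → a ≢ c → f a ≡ 0) → sum (map f allZ22) ≡ f c
sum-allZ22-concentrated f (false , false) z
  rewrite z (false , true) (λ ()) | z (true , false) (λ ()) | z (true , true) (λ ()) = +-identityʳ _
sum-allZ22-concentrated f (false , true) z
  rewrite z (false , false) (λ ()) | z (true , false) (λ ()) | z (true , true) (λ ()) = +-identityʳ _
sum-allZ22-concentrated f (true , false) z
  rewrite z (false , false) (λ ()) | z (false , true) (λ ()) | z (true , true) (λ ()) = +-identityʳ _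
sum-allZ22-concentrated f (true , true) z
  rewrite z (false , false) (λ ()) | z (false , true) (λ ()) | z (true , false) (λ ()) = +-identityʳ _

sum-allZ22-zero : (f : Z22 → ℕ) → (∀ a → f a ≡ 0) → sum (map f allZ22) ≡ 0
sum-allZ22-zero f z = trans (sum-allZ22-concentrated f 0² (λ a _ → z a)) (z 0²)

foldr-⊔-lub : ∀ {A : Set} (f : A → ℕ) {k} xs → (∀ x → f x ≤ k) → foldr _⊔_ 0 (map f xs) ≤ k
foldr-⊔-lub f []       _ = z≤n
foldr-⊔-lub f (x ∷ xs) h = ⊔-lub (h x) (foldr-⊔-lub f xs h)

max-allZ22-+-≤ : (f : Z22 → ℕ) {c k : ℕ} → (∀ x → f x + c ≤ k) → foldr _⊔_ 0 (map f allZ22) + c ≤ k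
max-allZ22-+-≤ f {c} {k} h = subst (_ ≤_) (m∸n+n≡m c≤k)
  (+-monoˡ-≤ c (foldr-⊔-lub f allZ22 (λ x → m+n≤o⇒m≤o∸n (f x) (h x))))
  where
  c≤k : c ≤ k
  c≤k = m+n≤o⇒n≤o (f 0²) (h 0²)

+-mono-≤-inner : ∀ {a b c p q r} → a + c ≤ p + r → b ≤ q → a + b + c ≤ p + q + r
+-mono-≤-inner {a} {b} {c} {p} {q} {r} a+c≤p+r b≤q = begin
  a + b + c  ≡⟨ xy∙z≈xz∙y a b c ⟩
  a + c + b  ≤⟨ +-mono-≤ a+c≤p+r b≤q ⟩
  p + r + q  ≡⟨ xy∙z≈xz∙y p r q ⟩
  p + q + r  ∎
  where open ≤-Reasoning

n≤1+k⇒n≤k+1⊓n : ∀ {n} k → n ≤ suc k → n ≤ k + 1 ⊓ n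
n≤1+k⇒n≤k+1⊓n {zero}  k _         = z≤n
n≤1+k⇒n≤k+1⊓n {suc n} k (s≤s n≤k) = subst (suc n ≤_) (+-comm 1 k) (s≤s n≤k)

1⊓-mono : ∀ {a b} → (1 ≤ a → 1 ≤ b) → 1 ⊓ a ≤ 1 ⊓ b
1⊓-mono {zero}  _ = z≤n
1⊓-mono {suc _} h = ≤-reflexive (sym (m≤n⇒m⊓n≡m (h (s≤s z≤n))))

tradeoff-bound : ∀ u {c} → u ≤ 3 → c ≤ 3 → Tradeoff u c → u + c ≤ 2 + 1 ⊓ u + 1 ⊓ c
tradeoff-bound 0 _ c≤3 _         = n≤1+k⇒n≤k+1⊓n 2 c≤3
tradeoff-bound 1 _ c≤3 _         = s≤s (n≤1+k⇒n≤k+1⊓n 2 c≤3)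
tradeoff-bound 2 _ _ (_ , 2≤⇒c≤2) = s≤s (s≤s (n≤1+k⇒n≤k+1⊓n 1 (2≤⇒c≤2 ≤-refl)))
tradeoff-bound 3 _ _ (3≤⇒c≤1 , _) = s≤s (s≤s (s≤s (n≤1+k⇒n≤k+1⊓n 0 (3≤⇒c≤1 ≤-refl))))
tradeoff-bound (suc (suc (suc (suc _)))) (s≤s (s≤s (s≤s ()))) _ _

+-mono-≤-inner-pred : ∀ {k b c q r} → 1 ≤ k → k + c ≤ 2 + 1 ⊓ k + r → b ≤ q → k ∸ 1 + b + c ≤ 2 + q + r
+-mono-≤-inner-pred {suc k} {c = c} _ k+c≤ b≤q = +-mono-≤-inner {a = k} {c = c} {p = 2} (≤-pred k+c≤) b≤q

-- Arithmetic in ℤ_m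

module _ {m : ℕ} .{{_ : NonZero m}} where

  toℕ-+ₘ : ∀ (i : Fin m) k → toℕ (i +ₘ k) ≡ (toℕ i + k) % m
  toℕ-+ₘ i k = toℕ-fromℕ< _

  [a%m+k]%m≡[a+k]%m : ∀ a k → (a % m + k) % m ≡ (a + k) % m
  [a%m+k]%m≡[a+k]%m a k = begin
    (a % m + k) % m          ≡⟨ %-distribˡ-+ (a % m) k m ⟩
    (a % m % m + k % m) % m  ≡⟨ cong (λ r → (r + k % m) % m) (m%n%n≡m%n a m) ⟩
    (a % m + k % m) % m      ≡⟨ sym (%-distribˡ-+ a k m) ⟩
    (a + k) % m              ∎
    where open ≡-Reasoning

  +ₘ-+ₘ : ∀ (i : Fin m) k l → (i +ₘ k) +ₘ l ≡ i +ₘ (k + l)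
  +ₘ-+ₘ i k l = toℕ-injective (begin
    toℕ ((i +ₘ k) +ₘ l)        ≡⟨ toℕ-+ₘ (i +ₘ k) l ⟩
    (toℕ (i +ₘ k) + l) % m     ≡⟨ cong (λ r → (r + l) % m) (toℕ-+ₘ i k) ⟩
    ((toℕ i + k) % m + l) % m  ≡⟨ [a%m+k]%m≡[a+k]%m (toℕ i + k) l ⟩
    (toℕ i + k + l) % m        ≡⟨ cong (_% m) (+-assoc (toℕ i) k l) ⟩
    (toℕ i + (k + l)) % m      ≡⟨ toℕ-+ₘ i (k + l) ⟨
    toℕ (i +ₘ (k + l))         ∎)
    where open ≡-Reasoning

  [t+k]%m≢t : ∀ {t k} → t < m → 0 < k → k < m → (t + k) % m ≢ t
  [t+k]%m≢t {t} {k} t<m 0<k k<m eq with t + k <? m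
  ... | yes t+k<m = <⇒≢ (m<m+n t 0<k) (sym (trans (sym (m<n⇒m%n≡m t+k<m)) eq))
  ... | no  t+k≮m = <⇒≢ t+k∸m<t (begin
      t + k ∸ m        ≡⟨ m<n⇒m%n≡m (<-trans t+k∸m<t t<m) ⟨
      (t + k ∸ m) % m  ≡⟨ m≤n⇒[n∸m]%m≡n%m m≤t+k ⟩
      (t + k) % m      ≡⟨ eq ⟩
      t                ∎)
    where
    open ≡-Reasoning
    m≤t+k : m ≤ t + k
    m≤t+k = ≮⇒≥ t+k≮m
    t+k∸m<t : t + k ∸ m < t
    t+k∸m<t = subst (t + k ∸ m <_) (m+n∸n≡m t m) (∸-monoˡ-< (+-monoʳ-< t k<m) m≤t+k)

  +ₘ-≢ : ∀ (i : Fin m) k → 0 < k → k < m → i +ₘ k ≢ i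
  +ₘ-≢ i k 0<k k<m eq = [t+k]%m≢t (toℕ<n i) 0<k k<m (trans (sym (toℕ-+ₘ i k)) (cong toℕ eq))

-- Vertices and layers of H_m

module _ {m : ℕ} {j j′ : Fin m} {x x′ y y′ z z′ : Z22} where

  ≢-layer : j ≢ j′ → (j , x , y , z) ≢ (j′ , x′ , y′ , z′)
  ≢-layer j≢j′ refl = j≢j′ refl

  ≢-x : x ≢ x′ → (j , x , y , z) ≢ (j′ , x′ , y′ , z′)
  ≢-x x≢x′ refl = x≢x′ refl

  ≢-y : y ≢ y′ → (j , x , y , z) ≢ (j′ , x′ , y′ , z′)
  ≢-y y≢y′ refl = y≢y′ refl

  ≢-z : z ≢ z′ → (j , x , y , z) ≢ (j′ , x′ , y′ , z′)
  ≢-z z≢z′ refl = z≢z′ refl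

  ≢-xy : (x , y) ≢ (x′ , y′) → (j , x , y , z) ≢ (j′ , x′ , y′ , z′)
  ≢-xy xy≢x′y′ refl = xy≢x′y′ refl

≢-fst : ∀ {a a′ b b′ : Z22} → a ≢ a′ → (a , b) ≢ (a′ , b′)
≢-fst a≢a′ = a≢a′ ∘ ,-injectiveˡ

≢-snd : ∀ {a a′ b b′ : Z22} → b ≢ b′ → (a , b) ≢ (a′ , b′)
≢-snd b≢b′ = b≢b′ ∘ ,-injectiveʳ

module _ {m : ℕ} .{{_ : NonZero m}} {v₁ v₂ v₃ v₄ : Vtx m} where

  edge₁ : Rule1 v₁ v₂ v₃ v₄ → EdgeLabelled v₁ v₂ v₃ v₄
  edge₁ = inj₁

  edge₂ : Rule2 v₁ v₂ v₃ v₄ → EdgeLabelled v₁ v₂ v₃ v₄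
  edge₂ = inj₂ ∘ inj₁

  edge₃ : Rule3 v₁ v₂ v₃ v₄ → EdgeLabelled v₁ v₂ v₃ v₄
  edge₃ = inj₂ ∘ inj₂ ∘ inj₁

  edge₄ : Rule4 v₁ v₂ v₃ v₄ → EdgeLabelled v₁ v₂ v₃ v₄
  edge₄ = inj₂ ∘ inj₂ ∘ inj₂

module _ {m : ℕ} (A : Vtx m → Bool) (j : Fin m) where

  A₂-witness : ∀ {x y} → A₂ A j x y ≡ true → ∃ λ z → A (j , x , y , z) ≡ true
  A₂-witness {x} {y} = any-allZ22⁻ (A₃ A j x y)

  A₁-witness : ∀ {x} → A₁ A j x ≡ true → ∃₂ λ y z → A (j , x , y , z) ≡ true
  A₁-witness {x} h with y , A₂y ← any-allZ22⁻ (A₂ A j x) h = y , A₂-witness A₂y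

  A₂⇒A₁ : ∀ {x y} → A₂ A j x y ≡ true → A₁ A j x ≡ true
  A₂⇒A₁ {x} = any-allZ22⁺ (A₂ A j x)

ε-concentrated : ∀ {m} (A : Vtx m → Bool) i {x₀ y₀} →
                 (∀ x y → (x , y) ≢ (x₀ , y₀) → card (A₃ A i x y) ≤ 1) →
                 ε A i ≡ card (A₃ A i x₀ y₀) ∸ 1
ε-concentrated A i {x₀} {y₀} thin =
  trans (sum-allZ22-concentrated _ x₀ λ x x≢x₀ →
           sum-allZ22-zero _ λ y → m≤n⇒m∸n≡0 (thin x y (x≢x₀ ∘ ,-injectiveˡ)))
        (sum-allZ22-concentrated _ y₀ λ y y≢y₀ → m≤n⇒m∸n≡0 (thin x₀ y (y≢y₀ ∘ ,-injectiveʳ)))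

module AroundLayer {m : ℕ} .{{_ : NonZero m}} (4≤m : 4 ≤ m) (A : Vtx m → Bool) (indep : Independent A) (i : Fin m) where

  j₂ j₃ : Fin m
  j₂ = i +ₘ 2
  j₃ = i +ₘ 3

  cell : Z22 → Z22 → Z22 → Bool
  cell = A₃ A i

  column : Z22 → Z22 → Bool
  column = A₂ A j₂

  X₂ X₃ : Z22 → Bool
  X₂ = A₁ A j₂
  X₃ = A₁ A j₃

  j₂+ₘ1≡j₃ : j₂ +ₘ 1 ≡ j₃
  j₂+ₘ1≡j₃ = +ₘ-+ₘ i 2 1

  i≢j₂ : i ≢ j₂
  i≢j₂ = ≢-sym (+ₘ-≢ i 2 (s≤s z≤n) (≤-trans (s≤s (s≤s (s≤s z≤n))) 4≤m))

  i≢j₃ : i ≢ j₃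
  i≢j₃ = ≢-sym (+ₘ-≢ i 3 (s≤s z≤n) 4≤m)

  j₂≢j₃ : j₂ ≢ j₃
  j₂≢j₃ = ≢-sym (subst (_≢ j₂) j₂+ₘ1≡j₃ (+ₘ-≢ j₂ 1 (s≤s z≤n) (≤-trans (s≤s (s≤s z≤n)) 4≤m)))

  cell-≤3 : ∀ x y → card (cell x y) ≤ 3
  cell-≤3 x y = ≮⇒≥ λ 4≤card → let full = card≥4⇒full (cell x y) 4≤card in
    indep (i , x , y , (false , false)) (i , x , y , (false , true))
          (i , x , y , (true , false)) (i , x , y , (true , true))
      (≢-z λ ()) (≢-z λ ()) (≢-z λ ()) (≢-z λ ()) (≢-z λ ()) (≢-z λ ())
      (full _) (full _) (full _) (full _)
      (edge₁ (refl , refl , refl , refl , refl , refl , refl , refl , refl))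

  column-≤3 : ∀ x → card (column x) ≤ 3
  column-≤3 x = ≮⇒≥ λ 4≤card →
    let full = card≥4⇒full (column x) 4≤card
        (z₀ , v₀) = A₂-witness A j₂ (full (false , false))
        (z₁ , v₁) = A₂-witness A j₂ (full (false , true))
        (z₂ , v₂) = A₂-witness A j₂ (full (true , false))
        (z₃ , v₃) = A₂-witness A j₂ (full (true , true))
    in indep (j₂ , x , (false , false) , z₀) (j₂ , x , (false , true) , z₁)
             (j₂ , x , (true , false) , z₂) (j₂ , x , (true , true) , z₃)
         (≢-y λ ()) (≢-y λ ()) (≢-y λ ()) (≢-y λ ()) (≢-y λ ()) (≢-y λ ())
         v₀ v₁ v₂ v₃
         (edge₂ (refl , refl , refl , x⊕x⊕x⊕x≡0² x ,
           ≢-snd (λ ()) , ≢-snd (λ ()) , ≢-snd (λ ()) , ≢-snd (λ ()) , ≢-snd (λ ()) , ≢-snd (λ ())))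

  X₃-≤3 : card X₃ ≤ 3
  X₃-≤3 = ≮⇒≥ λ 4≤card →
    let full = card≥4⇒full X₃ 4≤card
        (y₀ , z₀ , v₀) = A₁-witness A j₃ (full (false , false))
        (y₁ , z₁ , v₁) = A₁-witness A j₃ (full (false , true))
        (y₂ , z₂ , v₂) = A₁-witness A j₃ (full (true , false))
        (y₃ , z₃ , v₃) = A₁-witness A j₃ (full (true , true))
    in indep (j₃ , (false , false) , y₀ , z₀) (j₃ , (false , true) , y₁ , z₁)
             (j₃ , (true , false) , y₂ , z₂) (j₃ , (true , true) , y₃ , z₃)
         (≢-x λ ()) (≢-x λ ()) (≢-x λ ()) (≢-x λ ()) (≢-x λ ()) (≢-x λ ())
         v₀ v₁ v₂ v₃
         (edge₂ (refl , refl , refl , refl ,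
           ≢-fst (λ ()) , ≢-fst (λ ()) , ≢-fst (λ ()) , ≢-fst (λ ()) , ≢-fst (λ ()) , ≢-fst (λ ())))

  column-X₃-no-common-sum : ∀ x → ¬ CommonSum (column x) X₃
  column-X₃-no-common-sum x (common-sum {a} {b} {c} {d} a≢b c≢d Sa Sb Tc Td a⊕b≡c⊕d) =
    let (za , va) = A₂-witness A j₂ Sa
        (zb , vb) = A₂-witness A j₂ Sb
        (yc , zc , vc) = A₁-witness A j₃ Tc
        (yd , zd , vd) = A₁-witness A j₃ Td
    in indep (j₂ , x , a , za) (j₂ , x , b , zb) (j₃ , c , yc , zc) (j₃ , d , yd , zd)
         (≢-y a≢b) (≢-layer j₂≢j₃) (≢-layer j₂≢j₃) (≢-layer j₂≢j₃) (≢-layer j₂≢j₃) (≢-x c≢d)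
         va vb vc vd
         (edge₃ (refl , sym j₂+ₘ1≡j₃ , sym j₂+ₘ1≡j₃ , refl , a≢b , ⊕≡⊕⇒sum≡0² a b c d a⊕b≡c⊕d))

  distinct-cells-not-both-fat : ∀ {x y x′ y′} → (x , y) ≢ (x′ , y′) →
                                2 ≤ card (cell x y) → 2 ≤ card (cell x′ y′) → ⊥
  distinct-cells-not-both-fat {x} {y} {x′} {y′} xy≢x′y′ fat fat′ =
    let (z₁ , z₂ , z₁≢z₂ , v₁ , v₂) = card≥2⇒distinct₂ (cell x y) fat
        (u₁ , u₂ , u₁≢u₂ , w₁ , w₂) = card≥2⇒distinct₂ (cell x′ y′) fat′
    in indep (i , x , y , z₁) (i , x , y , z₂) (i , x′ , y′ , u₁) (i , x′ , y′ , u₂)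
         (≢-z z₁≢z₂) (≢-xy xy≢x′y′) (≢-xy xy≢x′y′) (≢-xy xy≢x′y′) (≢-xy xy≢x′y′) (≢-z u₁≢u₂)
         v₁ v₂ w₁ w₂
         (edge₄ (refl , refl , refl , z₁≢z₂ , inj₁ (refl , refl , refl , refl , xy≢x′y′ , u₁≢u₂)))

  fat-cell⇒column-≤1 : ∀ {x₀ y₀} → 2 ≤ card (cell x₀ y₀) → ∀ x → card (column x) ≤ 1
  fat-cell⇒column-≤1 {x₀} {y₀} fat x = ≮⇒≥ λ 2≤card →
    let (z₁ , z₂ , z₁≢z₂ , v₁ , v₂) = card≥2⇒distinct₂ (cell x₀ y₀) fat
        (y , y′ , y≢y′ , cy , cy′) = card≥2⇒distinct₂ (column x) 2≤card
        (u , w) = A₂-witness A j₂ cy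
        (u′ , w′) = A₂-witness A j₂ cy′
    in indep (i , x₀ , y₀ , z₁) (i , x₀ , y₀ , z₂) (j₂ , x , y , u) (j₂ , x , y′ , u′)
         (≢-z z₁≢z₂) (≢-layer i≢j₂) (≢-layer i≢j₂) (≢-layer i≢j₂) (≢-layer i≢j₂) (≢-y y≢y′)
         v₁ v₂ w w′
         (edge₄ (refl , refl , refl , z₁≢z₂ , inj₂ (inj₁ (refl , refl , refl , y≢y′))))

  cell-X₃-no-common-sum : ∀ x y → ¬ CommonSum (cell x y) X₃
  cell-X₃-no-common-sum x y (common-sum {a} {b} {c} {d} a≢b c≢d Sa Sb Tc Td a⊕b≡c⊕d) =
    let (yc , zc , vc) = A₁-witness A j₃ Tc
        (yd , zd , vd) = A₁-witness A j₃ Td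
    in indep (i , x , y , a) (i , x , y , b) (j₃ , c , yc , zc) (j₃ , d , yd , zd)
         (≢-z a≢b) (≢-layer i≢j₃) (≢-layer i≢j₃) (≢-layer i≢j₃) (≢-layer i≢j₃) (≢-x c≢d)
         Sa Sb vc vd
         (edge₄ (refl , refl , refl , a≢b , inj₂ (inj₂ (refl , refl , ⊕≡⊕⇒sum≡0² a b c d a⊕b≡c⊕d))))

  dominant-cell : ∃₂ λ x₀ y₀ → ∀ x y → (x , y) ≢ (x₀ , y₀) → card (cell x y) ≤ 1
  dominant-cell with any? (λ x → any? λ y → 2 ≤? card (cell x y))
  ... | yes (x₀ , y₀ , fat₀) =
    x₀ , y₀ , λ x y xy≢x₀y₀ → ≮⇒≥ λ fat → distinct-cells-not-both-fat xy≢x₀y₀ fat fat₀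
  ... | no  no-fat           = 0² , 0² , λ x y _ → ≮⇒≥ λ fat → no-fat (x , y , fat)

  column-nonempty⇒X₂-nonempty : ∀ x → 1 ≤ card (column x) → 1 ≤ card X₂
  column-nonempty⇒X₂-nonempty x nonempty =
    let (y , cy) = card≥1⇒member (column x) nonempty in member⇒card≥1 X₂ (A₂⇒A₁ A j₂ cy)

  bound-without-fat-cell : maxA₂ A j₂ + card X₃ ≤ 2 + 1 ⊓ card X₂ + 1 ⊓ card X₃
  bound-without-fat-cell = max-allZ22-+-≤ (card ∘ column) λ x → begin
    card (column x) + card X₃
      ≤⟨ tradeoff-bound _ (column-≤3 x) X₃-≤3 (no-common-sum⇒tradeoff (column-X₃-no-common-sum x)) ⟩
    2 + 1 ⊓ card (column x) + 1 ⊓ card X₃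
      ≤⟨ +-monoˡ-≤ (1 ⊓ card X₃) (+-monoʳ-≤ 2 (1⊓-mono (column-nonempty⇒X₂-nonempty x))) ⟩
    2 + 1 ⊓ card X₂ + 1 ⊓ card X₃
      ∎
    where open ≤-Reasoning

  bound-with-fat-cell : ∀ {x₀ y₀} → 2 ≤ card (cell x₀ y₀) →
                        card (cell x₀ y₀) ∸ 1 + maxA₂ A j₂ + card X₃ ≤ 2 + 1 ⊓ card X₂ + 1 ⊓ card X₃
  bound-with-fat-cell {x₀} {y₀} fat = +-mono-≤-inner-pred (≤-trans (s≤s z≤n) fat)
    (tradeoff-bound _ (cell-≤3 x₀ y₀) X₃-≤3 (no-common-sum⇒tradeoff (cell-X₃-no-common-sum x₀ y₀)))
    (foldr-⊔-lub (card ∘ column) allZ22 column≤1⊓X₂)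
    where
    column≤1⊓X₂ : ∀ x → card (column x) ≤ 1 ⊓ card X₂
    column≤1⊓X₂ x = ≤-trans (≤-reflexive (sym (m≥n⇒m⊓n≡n (fat-cell⇒column-≤1 fat x))))
                            (1⊓-mono (column-nonempty⇒X₂-nonempty x))

  bound : ε A i + maxA₂ A j₂ + card X₃ ≤ 2 + 1 ⊓ card X₂ + 1 ⊓ card X₃
  bound with x₀ , y₀ , others-thin ← dominant-cell
    rewrite ε-concentrated A i others-thin
    with 2 ≤? card (cell x₀ y₀)
  ... | yes fat = bound-with-fat-cell fat
  ... | no  thin rewrite m≤n⇒m∸n≡0 (≮⇒≥ thin) = bound-without-fat-cell

lemma1 : (m : ℕ) .{{_ : NonZero m}} → 4 ≤ m →
    (A : Vtx m → Bool) → Independent A → (i : Fin m) →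
    ε A i + maxA₂ A (i +ₘ 2) + card (A₁ A (i +ₘ 3))
      ≤ 2 + χ≠∅ (A₁ A (i +ₘ 2)) + χ≠∅ (A₁ A (i +ₘ 3))
lemma1 m 4≤m A indep i
  rewrite χ≠∅≡1⊓card (A₁ A (i +ₘ 2)) | χ≠∅≡1⊓card (A₁ A (i +ₘ 3)) = AroundLayer.bound 4≤m A indep i
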